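{- Let $\mathcal V=\langle A,\delta,\vec x_{in}\rangle$ be a VAS. Then $$\mathrm{Lim}\,\mathrm{Post}^*(\mathcal V)=\{\vec x_{in}+\delta(v)+\omega\,\delta(\pi)\mid v\in A^*\text{ and }\pi\text{ is productive in }\mathcal V\text{ for }v\}.$$
   Context: A VAS of dimension $d$ is $\mathcal V=\langle A,\delta,\vec x_{in}\rangle$ with $A$ finite, $\delta:A\to\mathbb Z^d$ (extended to a monoid morphism $A^*\to\mathbb Z^d$), $\vec x_{in}\in\mathbb N^d$; for $\vec x,\vec y\in\mathbb N^d$, $\vec x\xrightarrow{a}\vec y$ iff $\vec y-\vec x=\delta(a)$, extended to words; a word is fireable from $\vec x$ if $\vec x\xrightarrow{u}\vec y$ for some $\vec y$; $\mathrm{Post}^*(\mathcal V)=\{\vec y\in\mathbb N^d\mid\exists u,\ \vec x_{in}\xrightarrow{u}\vec y\}$. A sequence $\pi=(u_i)_{0\le i\le k}$ of words over $A$ is productive in $\mathcal V$ for $v=a_1\cdots a_k$ ($a_i\in A$) if the words $u_0^na_1u_1^n\cdots a_ku_k^n$ are fireable from $\vec x_{in}$ for all $n\ge1$; $\delta(\pi)=\sum_{i=0}^k\delta(u_i)$. $\mathbb N_\omega=\mathbb N\cup\{\omega\}$; $\omega\cdot0=0$, $\omega\cdot k=\omega$ for $k\ne0$, applied componentwise, and $n+\omega=\omega+n=\omega$ for $n\in\mathbb Z$. Convergence in $\mathbb N_\omega$: ultimately constant equal to $\ell$, or integer subsequence infinite tending to infinity with $\ell=\omega$; componentwise in $\mathbb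 N_\omega^d$. $\mathrm{Lim}\,\vec M$ is the set of limits of sequences of elements of $\vec M$. -}

module Defs where

open import Data.Nat using (ℕ; _≤_)
open import Data.Integer as ℤ using (ℤ; +_)
open import Data.Fin using (Fin)
open import Data.List using (List; []; _∷_; _++_; concat; replicate; length)
open import Data.Vec using (Vec; []; _∷_)
open import Data.Product using (Σ; ∃; _×_; _,_)
open import Data.Sum using (_⊎_)
open import Relation.Binary.PropositionalEquality using (_≡_)
open import Relation.Nullary using (¬_)

-- A VAS of dimension d over the finite alphabet A = Fin k.
record VAS (d : ℕ) : Set where
  field
    k   : ℕ
    δ   : Fin k → Fin d → ℤ
    xin : Fin d → ℕ

module _ {d : ℕ} (V : VAS d) where
  open VAS V

  Action : Set
  Action = Fin k

  Word : Set
  Word = List Action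

  δ* : Word → Fin d → ℤ
  δ* []       i = + 0
  δ* (a ∷ u)  i = δ a i ℤ.+ δ* u i

  Step : (Fin d → ℕ) → Action → (Fin d → ℕ) → Set
  Step x a y = ∀ i → (+ y i) ℤ.- (+ x i) ≡ δ a i

  data Run : (Fin d → ℕ) → Word → (Fin d → ℕ) → Set where
    run-[] : ∀ {x} → Run x [] x
    run-∷  : ∀ {x y z a u} → Step x a y → Run y u z → Run x (a ∷ u) z

  Fireable : (Fin d → ℕ) → Word → Set
  Fireable x u = ∃ λ y → Run x u y

  Post* : (Fin d → ℕ) → Set
  Post* y = ∃ λ u → Run xin u y

  _^w_ : Word → ℕ → Word
  u ^w n = concat (replicate n u)

  -- A sequence π = (u_0,…,u_k) for v = a_1⋯a_k, and the word u_0^n a_1 u_1^n ⋯ a_k u_k^n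
  Seq : Word → Set
  Seq v = Vec Word (Data.Nat.suc (length v))

  pump : (v : Word) → Seq v → ℕ → Word
  pump []      (u ∷ [])  n = u ^w n
  pump (a ∷ v) (u ∷ us)  n = (u ^w n) ++ (a ∷ pump v us n)

  Productive : (v : Word) → Seq v → Set
  Productive v π = ∀ n → 1 ≤ n → Fireable xin (pump v π n)

  δSeq : ∀ {m} → Vec Word m → Fin d → ℤ
  δSeq []       i = + 0
  δSeq (u ∷ us) i = δ* u i ℤ.+ δSeq us i

data ℕω : Set where
  fin : ℕ → ℕω
  ω   : ℕω

data ℤω : Set where
  int : ℤ → ℤω
  ω   : ℤω

ω· : ℤ → ℤω
ω· (+ 0) = int (+ 0)
ω· _     = ω

_+ω_ : ℤ → ℤω → ℤω
n +ω int m = int (n ℤ.+ m)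
n +ω ω     = ω

ℕω→ℤω : ℕω → ℤω
ℕω→ℤω (fin n) = int (+ n)
ℕω→ℤω ω       = ω

ConvergesTo : (ℕ → ℕ) → ℕω → Set
ConvergesTo s ℓ =
  (∃ λ N → ∀ n → N ≤ n → fin (s n) ≡ ℓ)
  ⊎ (ℓ ≡ ω × (∀ B → ∃ λ N → ∀ n → N ≤ n → B ≤ s n))

ConvergesToᵈ : ∀ {d} → (ℕ → Fin d → ℕ) → (Fin d → ℕω) → Set
ConvergesToᵈ s ℓ = ∀ i → ConvergesTo (λ n → s n i) (ℓ i)

Lim : ∀ {d} → ((Fin d → ℕ) → Set) → (Fin d → ℕω) → Set
Lim M ℓ = ∃ λ (s : ℕ → _) → (∀ n → M (s n)) × ConvergesToᵈ s ℓ

RHS : ∀ {d} (V : VAS d) → (Fin d → ℕω) → Set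
RHS V ℓ = ∃ λ v → Σ (Seq V v) λ π → Productive V v π ×
  (∀ i → ℕω→ℤω (ℓ i) ≡ ((+ VAS.xin V i) ℤ.+ δ* V v i) +ω ω· (δSeq V π i))

module Submission where

-- Well-quasi-orders are handled constructively as almost-full relations
-- (Vytiniotis–Coquand–Wahlstedt): an inductive certificate from which a good
-- pair i < j, g i ≤ g j, is computed for every sequence g.
--
-- The core is the pumping lemma for runs of the VAS: if run ρ reaches e, run ρ′
-- reaches e′ ≥ e, and the trace of ρ (actions with their source
-- configurations) embeds into that of ρ′, then cutting the word of ρ′ at the
-- embedded letters yields a sequence π, productive for the word v of ρ, with
-- δ(π) = e′ − e.
--
-- (⊆) From a sequence converging to ℓ extract a subsequence that is constant
-- on finite coordinates and strictly increasing on ω-coordinates; a good pair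
-- of (configuration, trace) for Dickson × Higman gives comparable runs, and
-- pumping them gives v and π with x_in + δ(v) + ω·δ(π) = ℓ.
-- (⊇) The configurations reached by the pumped words form an affine sequence
-- x_in + δ(v) + n·δ(π) of naturals, which converges to x_in + δ(v) + ω·δ(π).

open import Defs
import Algebra.Properties.CommutativeSemigroup as CommSemigroup
open import Data.Empty using (⊥; ⊥-elim)
open import Data.Fin using (Fin; zero; suc)
import Data.Fin.Properties as Fin
open import Data.Integer as ℤ using (ℤ; +_; -[1+_])
import Data.Integer.Properties as ℤ
open import Algebra.Properties.AbelianGroup ℤ.+-0-abelianGroup
  using (//-rightDividesˡ; //-rightDividesʳ; identityʳ-unique; ∙-cancelˡ)
open import Data.List using (List; []; _∷_; _++_; length)
import Data.List.Properties as List
open import Data.List.Relation.Binary.Sublist.Heterogeneous using (Sublist; []; _∷_; _∷ʳ_; minimum)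
open import Data.List.Relation.Binary.Sublist.Heterogeneous.Properties using (++⁺; ++ˡ; sublist?)
open import Data.List.Relation.Unary.All using (All; []; _∷_)
open import Data.List.Relation.Unary.First as First using (FirstView; first)
open import Data.List.Relation.Unary.First.Properties using (toView)
open import Data.Nat as ℕ using (ℕ; zero; suc; _≤_; _<_; _∸_; _⊔_; z≤n; s≤s)
import Data.Nat.Properties as ℕ
open import Data.Product using (∃; Σ; _×_; _,_; proj₁; proj₂)
open import Data.Product.Relation.Binary.Pointwise.NonDependent using (Pointwise; ×-decidable)
open import Data.Sum using (_⊎_; inj₁; inj₂; [_,_]; [_,_]′; swap)
import Data.Sum as Sum
open import Data.Unit using (⊤; tt)
open import Data.Vec using (_∷_; [])
open import Function using (_∘_)
open import Level using (0ℓ)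
open import Relation.Binary.Construct.Intersection using (_∩_)
open import Relation.Binary.Core using (Rel)
open import Relation.Binary.Definitions using (Decidable)
open import Relation.Binary.PropositionalEquality
  using (_≡_; _≗_; refl; sym; trans; cong; cong₂; subst; subst₂; module ≡-Reasoning)
open import Relation.Nullary using (¬_; Dec; yes; no; contradiction)
import Relation.Nullary.Decidable as Dec

private variable
  X Y A B : Set

infix  4 _⊆₂_
infixl 6 _↑_
infixr 5 _⊕_
infixr 5 _◃_

_↑_ : Rel X 0ℓ → X → Rel X 0ℓ
(R ↑ a) y z = R y z ⊎ R a y

-- Inclusion of relations, with explicit arguments for case analysis.
_⊆₂_ : Rel X 0ℓ → Rel X 0ℓ → Set
R ⊆₂ S = ∀ x y → R x y → S x y

data AF {X : Set} : Rel X 0ℓ → Set₁ where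
  full  : ∀ {R} → (∀ x y → R x y) → AF R
  later : ∀ {R} → (∀ a → AF (R ↑ a)) → AF R

↑-mono : ∀ {R S : Rel X 0ℓ} → R ⊆₂ S → ∀ a → (R ↑ a) ⊆₂ (S ↑ a)
↑-mono R⊆S a y z = Sum.map (R⊆S y z) (R⊆S a y)

↑-dec : ∀ {R : Rel X 0ℓ} → Decidable R → ∀ a → Decidable (R ↑ a)
↑-dec R? a y z = R? y z Dec.⊎-dec R? a y

af-mono : ∀ {R S : Rel X 0ℓ} → R ⊆₂ S → AF R → AF S
af-mono R⊆S (full r)  = full λ x y → R⊆S x y (r x y)
af-mono R⊆S (later h) = later λ a → af-mono (↑-mono R⊆S a) (h a)

good-pair : ∀ {R : Rel X 0ℓ} → AF R → (g : ℕ → X) → ∃ λ i → ∃ λ j → i < j × R (g i) (g j)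
good-pair (full r)  g = 0 , 1 , s≤s z≤n , r (g 0) (g 1)
good-pair (later h) g with good-pair (h (g 0)) (λ n → g (suc n))
... | i , j , i<j , inj₁ r = suc i , suc j , s≤s i<j , r
... | i , j , i<j , inj₂ r = 0 , suc i , s≤s z≤n , r

af-comap : ∀ {R : Rel X 0ℓ} (f : Y → X) → AF R → AF (λ x y → R (f x) (f y))
af-comap f (full r)  = full λ x y → r (f x) (f y)
af-comap f (later h) = later λ a → af-comap f (h (f a))

-- ≤ ↑ b is almost full, by induction on a bound n ≥ b: after an element c ≥ b
-- every pair is related, and after c < b we are in the case of c.
af-≤↑ : ∀ n b → b ≤ n → AF (_≤_ ↑ b)
af-≤↑ zero    b b≤0 = full λ y _ → inj₂ (ℕ.≤-trans b≤0 z≤n)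
af-≤↑ (suc n) b b≤n = later step
  where
  step : ∀ c → AF ((_≤_ ↑ b) ↑ c)
  step c with b ℕ.≤? c
  ... | yes b≤c = full λ _ _ → inj₂ (inj₂ b≤c)
  ... | no  b≰c = af-mono (λ _ _ → Sum.map inj₁ inj₁)
                          (af-≤↑ n c (ℕ.≤-pred (ℕ.≤-trans (ℕ.≰⇒> b≰c) b≤n)))

af-≤ : AF _≤_
af-≤ = later λ b → af-≤↑ b b ℕ.≤-refl

_⊕_ : Rel A 0ℓ → Rel B 0ℓ → Rel (A ⊎ B) 0ℓ
(P ⊕ Q) (inj₁ x) (inj₁ y) = P x y
(P ⊕ Q) (inj₂ x) (inj₂ y) = Q x y
(P ⊕ Q) _        _        = ⊥

_◃_ : (A : Set) → Rel B 0ℓ → Rel (A ⊎ B) 0ℓ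
(A ◃ Q) (inj₁ _) _        = ⊤
(A ◃ Q) (inj₂ x) (inj₂ y) = Q x y
(A ◃ Q) (inj₂ _) (inj₁ _) = ⊥

af-◃ : ∀ {Q : Rel B 0ℓ} → AF Q → AF (A ◃ Q)
af-◃ {A = A} {Q = Q} (full q) = later λ c → full (tops c)
  where
  tops : ∀ c x y → ((A ◃ Q) ↑ c) x y
  tops c        (inj₁ _) _        = inj₁ tt
  tops c        (inj₂ x) (inj₂ y) = inj₁ (q x y)
  tops (inj₁ _) (inj₂ x) (inj₁ _) = inj₂ tt
  tops (inj₂ b) (inj₂ x) (inj₁ _) = inj₂ (q b x)
af-◃ {A = A} {Q = Q} (later h) = later λ
  { (inj₁ a) → full λ { (inj₁ _) _ → inj₁ tt ; (inj₂ _) _ → inj₂ tt }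
  ; (inj₂ b) → af-mono (lower b) (af-◃ (h b)) }
  where
  lower : ∀ b → A ◃ Q ↑ b ⊆₂ (A ◃ Q) ↑ inj₂ b
  lower b (inj₁ _) _        _        = inj₁ tt
  lower b (inj₂ _) (inj₂ _) (inj₁ r) = inj₁ r
  lower b (inj₂ _) (inj₂ _) (inj₂ r) = inj₂ r

-- The sum lemma when the left relation is full: after a left element the
-- whole left summand lies below (af-◃); after a right element b we recurse
-- on the certificate of Q, the full case being af-◃ again with sides swapped.
af-⊕-fullˡ : ∀ {P : Rel A 0ℓ} {Q : Rel B 0ℓ} → (∀ x y → P x y) → AF Q → AF (P ⊕ Q)
af-⊕-fullˡ {A = A} {B = B} {P = P} {Q = Q} p aq = later λ
  { (inj₁ a) → af-mono (left a) (af-◃ aq)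
  ; (inj₂ b) → right b aq }
  where
  left : ∀ a → A ◃ Q ⊆₂ (P ⊕ Q) ↑ inj₁ a
  left a (inj₁ x) (inj₁ y) _ = inj₁ (p x y)
  left a (inj₁ x) (inj₂ _) _ = inj₂ (p a x)
  left a (inj₂ _) (inj₂ _) r = inj₁ r
  right : ∀ b → AF Q → AF ((P ⊕ Q) ↑ inj₂ b)
  right b (full q)  = af-mono flipped (af-comap swap (af-◃ (full p)))
    where
    flipped : ∀ x y → (B ◃ P) (swap x) (swap y) → ((P ⊕ Q) ↑ inj₂ b) x y
    flipped (inj₂ x) _        _ = inj₂ (q b x)
    flipped (inj₁ _) (inj₁ _) r = inj₁ r
  right b (later h) = af-mono raise (af-⊕-fullˡ p (h b))
    where
    raise : P ⊕ (Q ↑ b) ⊆₂ (P ⊕ Q) ↑ inj₂ b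
    raise (inj₁ _) (inj₁ _) r        = inj₁ r
    raise (inj₂ _) (inj₂ _) (inj₁ r) = inj₁ r
    raise (inj₂ _) (inj₂ _) (inj₂ r) = inj₂ r

af-⊕ : ∀ {P : Rel A 0ℓ} {Q : Rel B 0ℓ} → AF P → AF Q → AF (P ⊕ Q)
af-⊕ (full p) aq = af-⊕-fullˡ p aq
af-⊕ {P = P} {Q = Q} ap (full q) = af-mono unswap (af-comap swap (af-⊕-fullˡ q ap))
  where
  unswap : ∀ x y → (Q ⊕ P) (swap x) (swap y) → (P ⊕ Q) x y
  unswap (inj₁ _) (inj₁ _) r = r
  unswap (inj₂ _) (inj₂ _) r = r
af-⊕ {P = P} {Q = Q} ap@(later hp) aq@(later hq) = later λ c →
  [_,_] {C = λ c → AF ((P ⊕ Q) ↑ c)}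
        (λ a → af-mono (left a) (af-⊕ (hp a) aq))
        (λ b → af-mono (right b) (af-⊕ ap (hq b))) c
  where
  left : ∀ a → (P ↑ a) ⊕ Q ⊆₂ (P ⊕ Q) ↑ inj₁ a
  left a (inj₁ _) (inj₁ _) r = r
  left a (inj₂ _) (inj₂ _) r = inj₁ r
  right : ∀ b → P ⊕ (Q ↑ b) ⊆₂ (P ⊕ Q) ↑ inj₂ b
  right b (inj₁ _) (inj₁ _) r = inj₁ r
  right b (inj₂ _) (inj₂ _) r = r

-- After a first element c, elements y are sorted by whether R c y holds; each
-- class is controlled by one of the two induction hypotheses, and af-⊕ joins them.
af-∩ : ∀ {R S : Rel X 0ℓ} → AF R → Decidable R → AF S → AF (R ∩ S)
af-∩ (full r) R? aS = af-mono (λ x y s → r x y , s) aS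
af-∩ aR@(later _) R? (full s) = af-mono (λ x y r → r , s x y) aR
af-∩ {X = X} {R = R} {S = S} aR@(later hR) R? aS@(later hS) = later λ c →
  af-mono (sorted-sound c)
    (af-comap (λ y → sort y (R? c y)) (af-⊕ (af-∩ aR R? (hS c)) (af-∩ (hR c) (↑-dec R? c) aS)))
  where
  sort : ∀ {P : Set} → X → Dec P → X ⊎ X
  sort y (yes _) = inj₁ y
  sort y (no _)  = inj₂ y
  sorted-sound : ∀ c y z → ((R ∩ (S ↑ c)) ⊕ ((R ↑ c) ∩ S)) (sort y (R? c y)) (sort z (R? c z)) →
                 ((R ∩ S) ↑ c) y z
  sorted-sound c y z r with R? c y | R? c z
  sorted-sound c y z (ryz , inj₁ syz) | yes _   | yes _ = inj₁ (ryz , syz)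
  sorted-sound c y z (_   , inj₂ scy) | yes rcy | yes _ = inj₂ (rcy , scy)
  sorted-sound c y z (inj₁ ryz , syz) | no _    | no _  = inj₁ (ryz , syz)
  sorted-sound c y z (inj₂ rcy , _)   | no ¬rcy | no _  = contradiction rcy ¬rcy

af-× : ∀ {R : Rel A 0ℓ} {S : Rel B 0ℓ} → AF R → Decidable R → AF S → AF (Pointwise R S)
af-× aR R? aS =
  af-mono (λ { (_ , _) (_ , _) r → r })
          (af-∩ (af-comap proj₁ aR) (λ p q → R? (proj₁ p) (proj₁ q)) (af-comap proj₂ aS))

-- Equality on a finite set is almost full (a finite set is a sum of points).
af-≡-Fin : ∀ k → AF (_≡_ {A = Fin k})
af-≡-Fin zero    = full λ ()
af-≡-Fin (suc k) = af-mono decode (af-comap view (af-⊕ (full λ _ _ → refl) (af-≡-Fin k)))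
  where
  view : Fin (suc k) → ⊤ ⊎ Fin k
  view zero    = inj₁ tt
  view (suc i) = inj₂ i
  decode : ∀ x y → (_≡_ ⊕ _≡_) (view x) (view y) → x ≡ y
  decode zero    zero    _ = refl
  decode (suc i) (suc j) e = cong suc e

_≤ᶜ_ : ∀ {m} → (Fin m → ℕ) → (Fin m → ℕ) → Set
x ≤ᶜ y = ∀ i → x i ≤ y i

_≤ᶜ?_ : ∀ {m} → Decidable (_≤ᶜ_ {m})
x ≤ᶜ? y = Fin.all? λ i → x i ℕ.≤? y i

dickson : ∀ m → AF (_≤ᶜ_ {m})
dickson zero    = full λ _ _ ()
dickson (suc m) = af-mono glue (af-comap split (af-× af-≤ ℕ._≤?_ (dickson m)))
  where
  split : (Fin (suc m) → ℕ) → ℕ × (Fin m → ℕ)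
  split x = x zero , λ i → x (suc i)
  glue : ∀ x y → Pointwise _≤_ _≤ᶜ_ (split x) (split y) → x ≤ᶜ y
  glue x y (x₀≤y₀ , _)  zero    = x₀≤y₀
  glue x y (_ , tail≤)  (suc i) = tail≤ i

embed-avoiding : ∀ {R : Rel X 0ℓ} {a u v} → All (λ y → ¬ R a y) u → Sublist (R ↑ a) u v → Sublist R u v
embed-avoiding avoid          []           = []
embed-avoiding avoid          (y ∷ʳ e)     = y ∷ʳ embed-avoiding avoid e
embed-avoiding (_ ∷ avoid)    (inj₁ r ∷ e) = r ∷ embed-avoiding avoid e
embed-avoiding (¬ray ∷ _)     (inj₂ r ∷ e) = contradiction r ¬ray

embed-by-length : ∀ {R : Rel X 0ℓ} → (∀ x y → R x y) → ∀ u v → length u ≤ length v → Sublist R u v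
embed-by-length r []      v       _         = minimum v
embed-by-length r (x ∷ u) (y ∷ v) (s≤s u≤v) = r x y ∷ embed-by-length r u v u≤v

data Cut (R : Rel X 0ℓ) (a : X) (u : List X) : Set where
  avoids : All (λ y → ¬ R a y) u → Cut R a u
  cut-at : FirstView (λ y → ¬ R a y) (R a) u → Cut R a u

cut : ∀ {R : Rel X 0ℓ} → Decidable R → ∀ a u → Cut R a u
cut R? a u = [ cut-at ∘ toView , avoids ]′ (first (λ y → swap (Dec.toSum (R? a y))) u)

shape : ∀ {R : Rel X 0ℓ} {a u} → Cut R a u → List X ⊎ (X × List X × List X)
shape {u = u} (avoids _)                      = inj₁ u
shape (cut-at (First._++_∷_ {u₁} {y} _ _ u₂)) = inj₂ (y , u₁ , u₂)

cut-sound : ∀ {R : Rel X 0ℓ} {a w u v} (cu : Cut R a u) (cv : Cut R a v) →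
  (Sublist (R ↑ a) ⊕ Pointwise R (Pointwise (Sublist (R ↑ a)) (Sublist R ↑ w))) (shape cu) (shape cv) →
  (Sublist R ↑ (a ∷ w)) u v
cut-sound (avoids avoid) (avoids _) e = inj₁ (embed-avoiding avoid e)
cut-sound (cut-at (First._++_∷_ avoid _ _)) (cut-at (First._++_∷_ _ _ _)) (ryz , e₁ , inj₁ e₂) =
  inj₁ (++⁺ (embed-avoiding avoid e₁) (ryz ∷ e₂))
cut-sound (cut-at (First._++_∷_ {u₁} _ ray _)) (cut-at (First._++_∷_ _ _ _)) (_ , _ , inj₂ e₂) =
  inj₂ (++ˡ u₁ (ray ∷ e₂))
cut-sound (avoids _) (cut-at (First._++_∷_ _ _ _)) ()
cut-sound (cut-at (First._++_∷_ _ _ _)) (avoids _) ()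

-- After a word a ∷ w, a word u is sorted by its cut at a: words avoiding
-- a are compared along R ↑ a; cut words u₁ y u₂ are compared by y along R,
-- u₁ along R ↑ a and u₂ along Sublist R ↑ w (induction on w).
higman : ∀ {R : Rel X 0ℓ} → AF R → Decidable R → AF (Sublist R)
higman (full r) R? = af-mono (embed-by-length r) (af-comap length af-≤)
higman {R = R} aR@(later h) R? = later above
  where
  above : ∀ w → AF (Sublist R ↑ w)
  above []      = full λ u _ → inj₂ (minimum u)
  above (a ∷ w) =
    af-mono (λ u v → cut-sound (cut R? a u) (cut R? a v))
      (af-comap (λ u → shape (cut R? a u))
        (af-⊕ (higman (h a) (↑-dec R? a))
              (af-× aR R? (af-× (higman (h a) (↑-dec R? a)) (sublist? (↑-dec R? a)) (above w)))))

module ℕ+ = CommSemigroup ℕ.+-commutativeSemigroup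
module ℤ+ = CommSemigroup ℤ.+-commutativeSemigroup

module Runs {d : ℕ} (V : VAS d) where
  open VAS V

  Cfg : Set
  Cfg = Fin d → ℕ

  infixl 6 _+ᶜ_
  infixl 7 _·ᶜ_

  _+ᶜ_ : Cfg → Cfg → Cfg
  (x +ᶜ y) i = x i ℕ.+ y i

  _·ᶜ_ : ℕ → Cfg → Cfg
  (n ·ᶜ x) i = n ℕ.* x i

  -- Runs whose configurations are only determined up to pointwise equality:
  -- without function extensionality, this is needed to re-express endpoints.
  data Run≗ : Cfg → Word V → Cfg → Set where
    []  : ∀ {x y} → x ≗ y → Run≗ x [] y
    _∷_ : ∀ {x y z a u} → Step V x a y → Run≗ y u z → Run≗ x (a ∷ u) z

  Fireable≗ : Cfg → Word V → Set
  Fireable≗ x u = ∃ λ y → Run≗ x u y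

  from-run : ∀ {x u y} → Run V x u y → Run≗ x u y
  from-run run-[]         = [] λ _ → refl
  from-run (run-∷ st ρ)   = st ∷ from-run ρ

  to-fireable : ∀ {x u} → Fireable≗ x u → Fireable V x u
  to-fireable {x} (_ , [] _)   = x , run-[]
  to-fireable (y , st ∷ ρ) with to-fireable (y , ρ)
  ... | z , ρ′ = z , run-∷ st ρ′

  step-displacement : ∀ {x a y} → Step V x a y → ∀ i → + y i ≡ + x i ℤ.+ δ a i
  step-displacement {x} {a} {y} st i = begin
    + y i                       ≡⟨ sym (//-rightDividesˡ (+ x i) (+ y i)) ⟩
    (+ y i ℤ.- + x i) ℤ.+ + x i ≡⟨ cong (ℤ._+ + x i) (st i) ⟩
    δ a i ℤ.+ + x i             ≡⟨ ℤ.+-comm (δ a i) (+ x i) ⟩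
    + x i ℤ.+ δ a i             ∎
    where open ≡-Reasoning

  displacement-step : ∀ {x a y} → (∀ i → + y i ≡ + x i ℤ.+ δ a i) → Step V x a y
  displacement-step {x} {a} {y} y≡x+δ i = begin
    + y i ℤ.- + x i               ≡⟨ cong (ℤ._- + x i) (y≡x+δ i) ⟩
    (+ x i ℤ.+ δ a i) ℤ.- + x i   ≡⟨ cong (ℤ._- + x i) (ℤ.+-comm (+ x i) (δ a i)) ⟩
    (δ a i ℤ.+ + x i) ℤ.- + x i   ≡⟨ //-rightDividesʳ (+ x i) (δ a i) ⟩
    δ a i                         ∎
    where open ≡-Reasoning

  step-resp : ∀ {x x′ a y y′} → Step V x a y → x ≗ x′ → y ≗ y′ → Step V x′ a y′
  step-resp {a = a} st x≗x′ y≗y′ i = subst₂ (λ p q → + q ℤ.- + p ≡ δ a i) (x≗x′ i) (y≗y′ i) (st i)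

  step-shift : ∀ {x a y} → Step V x a y → ∀ z → Step V (x +ᶜ z) a (y +ᶜ z)
  step-shift {x} {a} {y} st z = displacement-step λ i → begin
    + (y i ℕ.+ z i)               ≡⟨ ℤ.pos-+ (y i) (z i) ⟩
    + y i ℤ.+ + z i               ≡⟨ cong (ℤ._+ + z i) (step-displacement {x} {a} {y} st i) ⟩
    + x i ℤ.+ δ a i ℤ.+ + z i     ≡⟨ ℤ+.xy∙z≈xz∙y (+ x i) (δ a i) (+ z i) ⟩
    + x i ℤ.+ + z i ℤ.+ δ a i     ≡⟨ cong (ℤ._+ δ a i) (sym (ℤ.pos-+ (x i) (z i))) ⟩
    + (x i ℕ.+ z i) ℤ.+ δ a i     ∎
    where open ≡-Reasoning

  step-deterministic : ∀ {x x′ a y y′} → Step V x a y → Step V x′ a y′ → x ≗ x′ → y ≗ y′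
  step-deterministic {x} {x′} {a} {y} {y′} st st′ x≗x′ i = ℤ.+-injective (begin
    + y i             ≡⟨ step-displacement {x} {a} {y} st i ⟩
    + x i ℤ.+ δ a i   ≡⟨ cong (λ p → + p ℤ.+ δ a i) (x≗x′ i) ⟩
    + x′ i ℤ.+ δ a i  ≡⟨ sym (step-displacement {x′} {a} {y′} st′ i) ⟩
    + y′ i            ∎)
    where open ≡-Reasoning

  run-resp : ∀ {x x′ u y y′} → Run≗ x u y → x ≗ x′ → y ≗ y′ → Run≗ x′ u y′
  run-resp ([] x≗y) x≗x′ y≗y′ = [] λ i → trans (sym (x≗x′ i)) (trans (x≗y i) (y≗y′ i))
  run-resp (_∷_ {x} {z} {_} {a} st ρ) x≗x′ y≗y′ =
    step-resp {x} {_} {a} {z} {z} st x≗x′ (λ _ → refl) ∷ run-resp ρ (λ _ → refl) y≗y′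

  infixr 5 _++ᴿ_

  _++ᴿ_ : ∀ {x u y w z} → Run≗ x u y → Run≗ y w z → Run≗ x (u ++ w) z
  [] x≗y   ++ᴿ ρ′ = run-resp ρ′ (λ i → sym (x≗y i)) (λ _ → refl)
  (st ∷ ρ) ++ᴿ ρ′ = st ∷ (ρ ++ᴿ ρ′)

  run-shift : ∀ {x u y} → Run≗ x u y → ∀ z → Run≗ (x +ᶜ z) u (y +ᶜ z)
  run-shift ([] x≗y) z = [] λ i → cong (ℕ._+ z i) (x≗y i)
  run-shift (_∷_ {x} {y} {_} {a} st ρ) z = step-shift {x} {a} {y} st z ∷ run-shift ρ z

  run-displacement : ∀ {x u y} → Run≗ x u y → ∀ i → + y i ≡ + x i ℤ.+ δ* V u i
  run-displacement ([] x≗y) i = trans (cong +_ (sym (x≗y i))) (sym (ℤ.+-identityʳ _))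
  run-displacement {x} (_∷_ {y = y} {z} {a} {u} st ρ) i = begin
    + z i                         ≡⟨ run-displacement ρ i ⟩
    + y i ℤ.+ δ* V u i            ≡⟨ cong (ℤ._+ δ* V u i) (step-displacement {x} {a} {y} st i) ⟩
    + x i ℤ.+ δ a i ℤ.+ δ* V u i  ≡⟨ ℤ.+-assoc (+ x i) (δ a i) (δ* V u i) ⟩
    + x i ℤ.+ δ* V (a ∷ u) i      ∎
    where open ≡-Reasoning

  trace : ∀ {x u y} → Run≗ x u y → List (Action V × Cfg)
  trace ([] _)                  = []
  trace (_∷_ {x} {a = a} _ ρ)   = (a , x) ∷ trace ρ

  δ*-++ : ∀ u w i → δ* V (u ++ w) i ≡ δ* V u i ℤ.+ δ* V w i
  δ*-++ []      w i = sym (ℤ.+-identityˡ _)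
  δ*-++ (a ∷ u) w i = trans (cong (λ t → δ a i ℤ.+ t) (δ*-++ u w i)) (sym (ℤ.+-assoc (δ a i) _ _))

  δ*-^ : ∀ u n i → δ* V (_^w_ V u n) i ≡ + n ℤ.* δ* V u i
  δ*-^ u zero    i = refl
  δ*-^ u (suc n) i = begin
    δ* V (u ++ _^w_ V u n) i            ≡⟨ δ*-++ u (_^w_ V u n) i ⟩
    δ* V u i ℤ.+ δ* V (_^w_ V u n) i    ≡⟨ cong (λ t → δ* V u i ℤ.+ t) (δ*-^ u n i) ⟩
    δ* V u i ℤ.+ + n ℤ.* δ* V u i       ≡⟨ sym (ℤ.suc-* (+ n) (δ* V u i)) ⟩
    + suc n ℤ.* δ* V u i                ∎
    where open ≡-Reasoning

  δ*-pump : ∀ v π n i → δ* V (pump V v π n) i ≡ δ* V v i ℤ.+ + n ℤ.* δSeq V π i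
  δ*-pump [] (u ∷ []) n i = begin
    δ* V (_^w_ V u n) i                    ≡⟨ δ*-^ u n i ⟩
    + n ℤ.* δ* V u i                       ≡⟨ cong (λ t → + n ℤ.* t) (sym (ℤ.+-identityʳ _)) ⟩
    + n ℤ.* (δ* V u i ℤ.+ + 0)             ≡⟨ sym (ℤ.+-identityˡ _) ⟩
    + 0 ℤ.+ + n ℤ.* (δ* V u i ℤ.+ + 0)     ∎
    where open ≡-Reasoning
  δ*-pump (a ∷ v) (u ∷ π) n i = begin
    δ* V (_^w_ V u n ++ a ∷ pump V v π n) i
      ≡⟨ δ*-++ (_^w_ V u n) _ i ⟩
    δ* V (_^w_ V u n) i ℤ.+ (δ a i ℤ.+ δ* V (pump V v π n) i)
      ≡⟨ cong₂ (λ p q → p ℤ.+ (δ a i ℤ.+ q)) (δ*-^ u n i) (δ*-pump v π n i) ⟩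
    nu ℤ.+ (δ a i ℤ.+ (δ* V v i ℤ.+ nπ))
      ≡⟨ cong (λ t → nu ℤ.+ t) (sym (ℤ.+-assoc (δ a i) _ _)) ⟩
    nu ℤ.+ (δ* V (a ∷ v) i ℤ.+ nπ)
      ≡⟨ ℤ+.x∙yz≈y∙xz nu (δ* V (a ∷ v) i) nπ ⟩
    δ* V (a ∷ v) i ℤ.+ (nu ℤ.+ nπ)
      ≡⟨ cong (λ t → δ* V (a ∷ v) i ℤ.+ t) (sym (ℤ.*-distribˡ-+ (+ n) _ _)) ⟩
    δ* V (a ∷ v) i ℤ.+ + n ℤ.* δSeq V (u ∷ π) i ∎
    where
    open ≡-Reasoning
    nu nπ : ℤ
    nu = + n ℤ.* δ* V u i
    nπ = + n ℤ.* δSeq V π i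

  -- Iterating a loop: a run from c + D to c + D′ over u lifts to a run from
  -- c + n·D to c + n·D′ over uⁿ (shift the first copy by n·D, the rest by D′).
  iterate : ∀ {c D D′ u} → Run≗ (c +ᶜ D) u (c +ᶜ D′) → ∀ n →
            Run≗ (c +ᶜ n ·ᶜ D) (_^w_ V u n) (c +ᶜ n ·ᶜ D′)
  iterate ρ zero = [] λ _ → refl
  iterate {c} {D} {D′} ρ (suc n) =
    run-resp (run-shift ρ (n ·ᶜ D))
             (λ i → ℕ.+-assoc (c i) (D i) (n ℕ.* D i))
             (λ i → ℕ+.xy∙z≈xz∙y (c i) (D′ i) (n ℕ.* D i))
    ++ᴿ run-resp (run-shift (iterate ρ n) D′)
                 (λ _ → refl)
                 (λ i → ℕ+.xy∙z≈x∙zy (c i) (n ℕ.* D′ i) (D′ i))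

  offset : ∀ {c x} → c ≤ᶜ x → x ≗ c +ᶜ (λ i → x i ∸ c i)
  offset c≤x i = sym (ℕ.m+[n∸m]≡n (c≤x i))

  parallel-step : ∀ {c a c₁ x x₁ D} → Step V c a c₁ → Step V x a x₁ → x ≗ c +ᶜ D → x₁ ≗ c₁ +ᶜ D
  parallel-step {c} {a} {c₁} {x} {x₁} {D} st st′ x≗c+D =
    step-deterministic {x} {c +ᶜ D} {a} {x₁} {c₁ +ᶜ D} st′ (step-shift {c} {a} {c₁} st D) x≗c+D

  balance-∷ : ∀ a v w p (π : Seq V v) i → δ* V w i ≡ δ* V v i ℤ.+ δSeq V π i →
              δ* V (p ++ a ∷ w) i ≡ δ* V (a ∷ v) i ℤ.+ δSeq V (p ∷ π) i
  balance-∷ a v w p π i balance = begin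
    δ* V (p ++ a ∷ w) i
      ≡⟨ δ*-++ p (a ∷ w) i ⟩
    δ* V p i ℤ.+ (δ a i ℤ.+ δ* V w i)
      ≡⟨ cong (λ t → δ* V p i ℤ.+ (δ a i ℤ.+ t)) balance ⟩
    δ* V p i ℤ.+ (δ a i ℤ.+ (δ* V v i ℤ.+ δSeq V π i))
      ≡⟨ cong (λ t → δ* V p i ℤ.+ t) (sym (ℤ.+-assoc (δ a i) _ _)) ⟩
    δ* V p i ℤ.+ (δ* V (a ∷ v) i ℤ.+ δSeq V π i)
      ≡⟨ ℤ+.x∙yz≈y∙xz (δ* V p i) (δ* V (a ∷ v) i) _ ⟩
    δ* V (a ∷ v) i ℤ.+ δSeq V (p ∷ π) i ∎
    where open ≡-Reasoning

  _⊑_ : Action V × Cfg → Action V × Cfg → Set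
  _⊑_ = Pointwise _≡_ _≤ᶜ_

  record Pumped (c D : Cfg) (v w : Word V) : Set where
    field
      π       : Seq V v
      fires   : ∀ n → Fireable≗ (c +ᶜ n ·ᶜ D) (pump V v π n)
      balance : ∀ i → δ* V w i ≡ δ* V v i ℤ.+ δSeq V π i

  -- Cutting p w before the
  -- letters matched by the embedding gives loops u₀ ⋯ u_k: u₀ leads from
  -- c + D to c + D′, where c is the source of the first letter a of v and
  -- c + D′ its match; so u₀ⁿ leads from c + n·D to c + n·D′, where a fires,
  -- and the rest of v is pumped by induction with offset D′.
  pumping : ∀ {c e D x w e′ p v} (ρ : Run≗ c v e) (σ : Run≗ (c +ᶜ D) p x) (ρ′ : Run≗ x w e′) →
            Sublist _⊑_ (trace ρ) (trace ρ′) → e ≤ᶜ e′ → Pumped c D v (p ++ w)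
  pumping {c = c} {w = w} {e′ = e′} {p = p} ([] c≗e) σ ρ′ _ e≤e′ = record
    { π       = (p ++ w) ∷ []
    ; fires   = λ n → _ , iterate (run-resp (σ ++ᴿ ρ′) (λ _ → refl) (offset c≤e′)) n
    ; balance = λ i → sym (trans (ℤ.+-identityˡ _) (ℤ.+-identityʳ _)) }
    where
    c≤e′ : c ≤ᶜ e′
    c≤e′ i = subst (_≤ e′ i) (sym (c≗e i)) (e≤e′ i)
  pumping (_ ∷ _) σ ([] _) () e≤e′
  pumping {p = p} ρ σ (_∷_ {a = b} {u = w} st′ ρ′) (_ ∷ʳ ρ⊑ρ′) e≤e′ = record
    { π       = π
    ; fires   = fires
    ; balance = λ i → trans (cong (λ u → δ* V u i) (sym (List.++-assoc p (b ∷ []) w))) (balance i) }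
    where open Pumped (pumping ρ (σ ++ᴿ st′ ∷ [] (λ _ → refl)) ρ′ ρ⊑ρ′ e≤e′)
  pumping {c = c} {x = x} {p = p} (_∷_ {y = c₁} {a = a} {u = v} st ρ) σ (_∷_ {y = x₁} {u = w} st′ ρ′)
          ((refl , c≤x) ∷ ρ⊑ρ′) e≤e′ = record
    { π       = p ∷ π
    ; fires   = λ n → proj₁ (fires n) ,
                  iterate (run-resp σ (λ _ → refl) (offset c≤x)) n
                  ++ᴿ step-shift {c} {a} {c₁} st (n ·ᶜ D′) ∷ proj₂ (fires n)
    ; balance = λ i → balance-∷ a v w p π i (balance i) }
    where
    D′ : Cfg
    D′ i = x i ∸ c i
    x₁≗c₁+D′ : x₁ ≗ c₁ +ᶜ D′
    x₁≗c₁+D′ = parallel-step {c} {a} {c₁} {D = D′} st st′ (offset c≤x)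
    open Pumped (pumping ρ ([] λ i → sym (x₁≗c₁+D′ i)) ρ′ ρ⊑ρ′ e≤e′)

fin-injective : ∀ {a b} → fin a ≡ fin b → a ≡ b
fin-injective refl = refl

fin≢ω : ∀ {a} → fin a ≡ ω → ⊥
fin≢ω ()

ℕω→ℤω-fin : ∀ {l c} → ℕω→ℤω l ≡ int (+ c) → l ≡ fin c
ℕω→ℤω-fin {fin _} refl = refl

ℕω→ℤω-ω : ∀ {l} → ℕω→ℤω l ≡ ω → l ≡ ω
ℕω→ℤω-ω {ω} refl = refl

ω·-positive : ∀ {n} → 0 < n → ω· (+ n) ≡ ω
ω·-positive {suc _} _ = refl

affine-from-0 : ∀ (y : ℕ → ℕ) A D → (∀ n → + y n ≡ A ℤ.+ + suc n ℤ.* D) →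
                ∀ n → + y n ≡ + y 0 ℤ.+ + n ℤ.* D
affine-from-0 y A D y≡ n = begin
  + y n                          ≡⟨ y≡ n ⟩
  A ℤ.+ + suc n ℤ.* D            ≡⟨ cong (λ t → A ℤ.+ t) (ℤ.suc-* (+ n) D) ⟩
  A ℤ.+ (D ℤ.+ + n ℤ.* D)        ≡⟨ sym (ℤ.+-assoc A D (+ n ℤ.* D)) ⟩
  A ℤ.+ D ℤ.+ + n ℤ.* D          ≡⟨ cong (λ t → A ℤ.+ t ℤ.+ + n ℤ.* D) (sym (ℤ.*-identityˡ D)) ⟩
  A ℤ.+ + 1 ℤ.* D ℤ.+ + n ℤ.* D  ≡⟨ cong (ℤ._+ + n ℤ.* D) (sym (y≡ 0)) ⟩
  + y 0 ℤ.+ + n ℤ.* D            ∎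
  where open ≡-Reasoning

-- An affine sequence y n = A + (n+1)·D of naturals converges to A +ω ω·D:
-- it is constant if D = 0, unbounded if D > 0, and D < 0 is impossible.
affine-converges : ∀ (y : ℕ → ℕ) l A D → ℕω→ℤω l ≡ A +ω ω· D →
                   (∀ n → + y n ≡ A ℤ.+ + suc n ℤ.* D) → ConvergesTo y l
affine-converges y l A (+ zero) l≡ y≡ =
  inj₁ (0 , λ n _ → sym (ℕω→ℤω-fin (trans l≡ (cong int (sym (constant n))))))
  where
  constant : ∀ n → + y n ≡ A ℤ.+ + 0
  constant n = trans (y≡ n) (cong (λ t → A ℤ.+ t) (ℤ.*-zeroʳ (+ suc n)))
affine-converges y l A (+ suc k) l≡ y≡ = inj₂ (ℕω→ℤω-ω l≡ , λ B → B , λ n B≤n → ℕ.≤-trans B≤n (n≤y n))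
  where
  linear : ∀ n → y n ≡ y 0 ℕ.+ n ℕ.* suc k
  linear n = ℤ.+-injective
    (trans (affine-from-0 y A _ y≡ n) (cong (λ t → + y 0 ℤ.+ t) (sym (ℤ.pos-* n (suc k)))))
  n≤y : ∀ n → n ≤ y n
  n≤y n = subst (n ≤_) (sym (linear n)) (ℕ.≤-trans (ℕ.m≤m*n n (suc k)) (ℕ.m≤n+m (n ℕ.* suc k) (y 0)))
affine-converges y l A -[1+ k ] l≡ y≡ = ⊥-elim (ℕ.<-irrefl refl y₀<y₀)
  where
  n : ℕ
  n = suc (y 0)
  m : ℕ
  m = n ℕ.* suc k
  decrease : y n ℕ.+ m ≡ y 0
  decrease = ℤ.+-injective (begin
    + y n ℤ.+ + m
      ≡⟨ cong (ℤ._+ + m) (affine-from-0 y A _ y≡ n) ⟩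
    + y 0 ℤ.+ + n ℤ.* -[1+ k ] ℤ.+ + m
      ≡⟨ cong (λ t → + y 0 ℤ.+ t ℤ.+ + m) (sym (ℤ.neg-distribʳ-* (+ n) (+ suc k))) ⟩
    + y 0 ℤ.- (+ n ℤ.* + suc k) ℤ.+ + m
      ≡⟨ cong (λ t → + y 0 ℤ.- t ℤ.+ + m) (sym (ℤ.pos-* n (suc k))) ⟩
    + y 0 ℤ.- + m ℤ.+ + m
      ≡⟨ //-rightDividesˡ (+ m) (+ y 0) ⟩
    + y 0 ∎)
    where open ≡-Reasoning
  y₀<y₀ : y 0 < y 0
  y₀<y₀ = ℕ.≤-trans (ℕ.m≤m*n n (suc k)) (ℕ.≤-trans (ℕ.m≤n+m m (y n)) (ℕ.≤-reflexive decrease))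

-- How one coordinate behaves between two terms of the extracted subsequence:
-- it already equals its finite limit, or the limit is ω and it strictly grows.
Approach : ℕω → ℕ → ℕ → Set
Approach l x y = (fin x ≡ l × x ≡ y) ⊎ (l ≡ ω × x < y)

limit-coordinate : ∀ {l x y D} → Approach l x y → + y ≡ + x ℤ.+ D → ℕω→ℤω l ≡ (+ x) +ω ω· D
limit-coordinate {x = x} {D = D} (inj₁ (refl , refl)) x≡x+D
  rewrite identityʳ-unique (+ x) D (sym x≡x+D) = cong int (sym (ℤ.+-identityʳ (+ x)))
limit-coordinate {x = x} {y} {D} (inj₂ (refl , x<y)) y≡x+D =
  sym (cong ((+ x) +ω_) (trans (cong ω· D≡y-x) (ω·-positive (ℕ.m<n⇒0<n∸m x<y))))
  where
  D≡y-x : D ≡ + (y ∸ x)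
  D≡y-x = ∙-cancelˡ (+ x) D (+ (y ∸ x)) (trans (sym y≡x+D) (cong +_ (sym (ℕ.m+[n∸m]≡n (ℕ.<⇒≤ x<y)))))

eventually-all : ∀ {m} (P : Fin m → ℕ → Set) →
                 (∀ i → ∃ λ N → ∀ n → N ≤ n → P i n) → ∃ λ N → ∀ n → N ≤ n → ∀ i → P i n
eventually-all {zero}  P h = 0 , λ _ _ ()
eventually-all {suc m} P h with h zero | eventually-all (λ i → P (suc i)) (λ i → h (suc i))
... | N₀ , h₀ | N , hₛ = N₀ ⊔ N , λ
  { n le zero    → h₀ n (ℕ.≤-trans (ℕ.m≤m⊔n N₀ N) le)
  ; n le (suc i) → hₛ n (ℕ.≤-trans (ℕ.m≤n⊔m N₀ N) le) i }

increasing : ∀ (f : ℕ → ℕ) → (∀ m → f m < f (suc m)) → ∀ {m m′} → m < m′ → f m < f m′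
increasing f step {m} {suc m′} (s≤s m≤m′) with ℕ.m≤n⇒m<n∨m≡n m≤m′
... | inj₁ m<m′ = ℕ.<-trans (increasing f step m<m′) (step m′)
... | inj₂ refl = step m

module Subsequence {d} (s : ℕ → Fin d → ℕ) {ℓ : Fin d → ℕω} (conv : ConvergesToᵈ s ℓ) where

  NearAt : (Fin d → ℕ) → Fin d → ℕ → Set
  NearAt b i n = fin (s n i) ≡ ℓ i ⊎ (ℓ i ≡ ω × b i < s n i)

  eventually-near : ∀ b i → ∃ λ N → ∀ n → N ≤ n → NearAt b i n
  eventually-near b i with conv i
  ... | inj₁ (N , constant)      = N , λ n N≤n → inj₁ (constant n N≤n)
  ... | inj₂ (ℓ≡ω , unbounded) with unbounded (suc (b i))
  ...   | N , above = N , λ n N≤n → inj₂ (ℓ≡ω , above n N≤n)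

  near : ∀ b → ∃ λ N → ∀ i → NearAt b i N
  near b with eventually-all (NearAt b) (eventually-near b)
  ... | N , all-near = N , all-near N ℕ.≤-refl

  -- Each term is chosen near ℓ above the previous one.
  g : ℕ → ℕ
  bound : ℕ → Fin d → ℕ
  g m = proj₁ (near (bound m))
  bound zero    = λ _ → 0
  bound (suc m) = s (g m)

  g-near : ∀ m i → NearAt (bound m) i (g m)
  g-near m = proj₂ (near (bound m))

  growth : ∀ i → ℓ i ≡ ω → ∀ m → s (g m) i < s (g (suc m)) i
  growth i ℓ≡ω m with g-near (suc m) i
  ... | inj₁ reached     = ⊥-elim (fin≢ω (trans reached ℓ≡ω))
  ... | inj₂ (_ , above) = above

  approach : ∀ {m m′} → m < m′ → ∀ i → Approach (ℓ i) (s (g m) i) (s (g m′) i)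
  approach {m} {m′} m<m′ i with g-near m i | g-near m′ i
  ... | inj₁ reached | inj₁ reached′ = inj₁ (reached , fin-injective (trans reached (sym reached′)))
  ... | inj₁ reached | inj₂ (ℓ≡ω , _) = ⊥-elim (fin≢ω (trans reached ℓ≡ω))
  ... | inj₂ (ℓ≡ω , _) | _ = inj₂ (ℓ≡ω , increasing (λ m → s (g m) i) (growth i ℓ≡ω) m<m′)

module Inclusions {d} (V : VAS d) (ℓ : Fin d → ℕω) where
  open VAS V
  open Runs V

  rhs⊆lim : RHS V ℓ → Lim (Post* V) ℓ
  rhs⊆lim (v , π , productive , limit) =
    s , reach , λ i → affine-converges (λ n → s n i) (ℓ i) _ _ (limit i) (affine i)
    where
    fired : ∀ n → Fireable V xin (pump V v π (suc n))
    fired n = productive (suc n) (s≤s z≤n)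
    s : ℕ → Cfg
    s n = proj₁ (fired n)
    reach : ∀ n → Post* V (s n)
    reach n = pump V v π (suc n) , proj₂ (fired n)
    affine : ∀ i n → + s n i ≡ (+ xin i ℤ.+ δ* V v i) ℤ.+ + suc n ℤ.* δSeq V π i
    affine i n = begin
      + s n i
        ≡⟨ run-displacement (from-run (proj₂ (fired n))) i ⟩
      + xin i ℤ.+ δ* V (pump V v π (suc n)) i
        ≡⟨ cong (λ t → + xin i ℤ.+ t) (δ*-pump v π (suc n) i) ⟩
      + xin i ℤ.+ (δ* V v i ℤ.+ + suc n ℤ.* δSeq V π i)
        ≡⟨ sym (ℤ.+-assoc (+ xin i) (δ* V v i) _) ⟩
      + xin i ℤ.+ δ* V v i ℤ.+ + suc n ℤ.* δSeq V π i ∎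
      where open ≡-Reasoning

  af-runs : AF (Pointwise _≤ᶜ_ (Sublist _⊑_))
  af-runs = af-× (dickson d) _≤ᶜ?_ (higman af-⊑ (×-decidable Fin._≟_ _≤ᶜ?_))
    where
    af-⊑ : AF _⊑_
    af-⊑ = af-× (af-≡-Fin k) Fin._≟_ (dickson d)

  comparable-runs-pump : ∀ {v w e e′} (ρ : Run≗ xin v e) (ρ′ : Run≗ xin w e′) →
    Sublist _⊑_ (trace ρ) (trace ρ′) → e ≤ᶜ e′ →
    Σ (Seq V v) λ π → Productive V v π × (∀ i → + e′ i ≡ + e i ℤ.+ δSeq V π i)
  comparable-runs-pump {v} {w} {e} {e′} ρ ρ′ ρ⊑ρ′ e≤e′ = π , productive , grows
    where
    open Pumped (pumping {D = λ _ → 0} ρ ([] λ i → ℕ.+-identityʳ (xin i)) ρ′ ρ⊑ρ′ e≤e′)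
    xin+n·0≗xin : ∀ n → xin +ᶜ n ·ᶜ (λ _ → 0) ≗ xin
    xin+n·0≗xin n i = trans (cong (xin i ℕ.+_) (ℕ.*-zeroʳ n)) (ℕ.+-identityʳ (xin i))
    productive : Productive V v π
    productive n _ with fires n
    ... | y , run = to-fireable (y , run-resp run (xin+n·0≗xin n) (λ _ → refl))
    grows : ∀ i → + e′ i ≡ + e i ℤ.+ δSeq V π i
    grows i = begin
      + e′ i                                  ≡⟨ run-displacement ρ′ i ⟩
      + xin i ℤ.+ δ* V w i                    ≡⟨ cong (λ t → + xin i ℤ.+ t) (balance i) ⟩
      + xin i ℤ.+ (δ* V v i ℤ.+ δSeq V π i)   ≡⟨ sym (ℤ.+-assoc (+ xin i) (δ* V v i) _) ⟩
      + xin i ℤ.+ δ* V v i ℤ.+ δSeq V π i     ≡⟨ cong (ℤ._+ δSeq V π i) (sym (run-displacement ρ i)) ⟩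
      + e i ℤ.+ δSeq V π i                    ∎
      where open ≡-Reasoning

  lim⊆rhs : Lim (Post* V) ℓ → RHS V ℓ
  lim⊆rhs (s , reach , conv) = from-pair (good-pair af-runs (λ m → s (g m) , trace (ρ m)))
    where
    open Subsequence s conv
    word : ℕ → Word V
    word m = proj₁ (reach (g m))
    ρ : ∀ m → Run≗ xin (word m) (s (g m))
    ρ m = from-run (proj₂ (reach (g m)))
    from-pair : (∃ λ m₁ → ∃ λ m₂ → m₁ < m₂ × s (g m₁) ≤ᶜ s (g m₂) × Sublist _⊑_ (trace (ρ m₁)) (trace (ρ m₂))) →
                RHS V ℓ
    from-pair (m₁ , m₂ , m₁<m₂ , S≤S′ , ρ⊑ρ′) with comparable-runs-pump (ρ m₁) (ρ m₂) ρ⊑ρ′ S≤S′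
    ... | π , productive , grows = word m₁ , π , productive , λ i →
      subst (λ A → ℕω→ℤω (ℓ i) ≡ A +ω ω· (δSeq V π i)) (run-displacement (ρ m₁) i)
            (limit-coordinate (approach m₁<m₂ i) (grows i))

proposition4p5 : ∀ {d} (V : VAS d) (ℓ : Fin d → ℕω) →
    (Lim (Post* V) ℓ → RHS V ℓ) × (RHS V ℓ → Lim (Post* V) ℓ)
proposition4p5 V ℓ = lim⊆rhs , rhs⊆lim
  where open Inclusions V ℓ
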